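{- Let $G$ be a finite simple graph with vertex set $V(G)=\{1,\dots,n\}$ and let $t\ge 2$ be an integer. Let $x\in\Delta^{n-1}$ be a minimizer of $\Phi(G,\cdot)$ over $\Delta^{n-1}$, i.e. $\Phi(G,x)=\min\{\Phi(G,y): y\in\Delta^{n-1}\}$. If $i,j\in \operatorname{Supp}(x)$ and $i$ is not adjacent to $j$, then $\delta_{ij}(x)=0$.
   Context: $\Delta^{n-1}=\{x=(x_1,\dots,x_n)\in\mathbb{R}^n : x_i\ge 0 \text{ for all } i,\ \sum_i x_i=1\}$, and $\operatorname{Supp}(x)=\{v : x_v\neq 0\}$. For $v\in V(G)$, $c(v)$ is the order of the largest clique of $G$ containing $v$. Define \[ \Phi(G,x)=\sum_{v\in V(G)}\frac{x_v}{c(v)^t}\binom{c(v)}{t}-\sum_{K_t\subseteq G}\prod_{v\in V(K_t)}x_v, \] where the second sum runs over all copies of $K_t$ in $G$. For $i,j\in V(G)$, with $N(i)$ the neighbourhood of $i$, \[ \delta_{ij}(x)=\left(\frac{1}{c(i)^t}\binom{c(i)}{t}-\frac{1}{c(j)^t}\binom{c(j)}{t}\right)-\left(\sum_{K_{t-1}\subseteq N(i)}\prod_{v\in V(K_{t-1})}x_v-\sum_{K_{t-1}\subseteq N(j)}\prod_{v\in V(K_{t-1})}x_v\right), \] where the sums run over copies of $K_{t-1}$ in the subgraphs induced by $N(i)$, respectively $N(j)$. -}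

module Defs where

open import Level using (Level; _⊔_) renaming (suc to lsuc)
open import Data.Nat using (ℕ; zero; suc; _^_) renaming (_≟_ to _≟ℕ_)
open import Data.Nat.Combinatorics using (_C_)
open import Data.Bool using (Bool; true; false; _∧_; _∨_; not; if_then_else_)
open import Data.Fin using (Fin) renaming (zero to fz; suc to fs; _≟_ to _≟F_)
open import Data.List using (List; []; _∷_; _++_; map; foldr; filter)
open import Data.Vec.Functional using (Vector)
import Data.Nat
import Data.Product
import Relation.Nullary.Decidable
open import Relation.Binary using (Rel; IsTotalOrder)
open import Relation.Binary.PropositionalEquality using (_≡_)
open import Relation.Nullary using (¬_)
open import Relation.Nullary.Decidable using (⌊_⌋)
open import Algebra.Core using (Op₁; Op₂)
open import Algebra.Structures using (IsCommutativeRing)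

-- Ordered fields (ℝ is the intended instance).  The inverse is a total
-- function, required to be a two-sided inverse on nonzero elements.

record OrderedField (c ℓ₁ ℓ₂ : Level) : Set (lsuc (c ⊔ ℓ₁ ⊔ ℓ₂)) where
  infixl 7 _*_
  infixl 6 _+_ _-_
  infix 4 _≈_ _≤_
  field
    Carrier : Set c
    _≈_ : Rel Carrier ℓ₁
    _≤_ : Rel Carrier ℓ₂
    _+_ : Op₂ Carrier
    _*_ : Op₂ Carrier
    -_  : Op₁ Carrier
    0#  : Carrier
    1#  : Carrier
    _⁻¹ : Op₁ Carrier
    isCommutativeRing : IsCommutativeRing _≈_ _+_ _*_ -_ 0# 1#
    isTotalOrder : IsTotalOrder _≈_ _≤_
    0≉1 : ¬ (0# ≈ 1#)
    ⁻¹-inverse : ∀ {x} → ¬ (x ≈ 0#) → x * (x ⁻¹) ≈ 1#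
    +-monoˡ-≤ : ∀ {x y} z → x ≤ y → x + z ≤ y + z
    *-nonneg : ∀ {x y} → 0# ≤ x → 0# ≤ y → 0# ≤ x * y

  _-_ : Op₂ Carrier
  x - y = x + (- y)

  fromℕ : ℕ → Carrier
  fromℕ zero = 0#
  fromℕ (suc n) = 1# + fromℕ n

  sumF : ∀ {n} → (Fin n → Carrier) → Carrier
  sumF {zero} f = 0#
  sumF {suc n} f = f fz + sumF (λ i → f (fs i))

  sumL : List Carrier → Carrier
  sumL = foldr _+_ 0#

  prodSub : ∀ {n} → Vector Bool n → Vector Carrier n → Carrier
  prodSub {zero} S x = 1#
  prodSub {suc n} S x =
    (if S fz then x fz else 1#) * prodSub (λ i → S (fs i)) (λ i → x (fs i))

-- Finite simple graphs on vertex set Fin n (vertices 1..n ↔ Fin n).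

record Graph (n : ℕ) : Set where
  field
    adj : Fin n → Fin n → Bool
    adj-sym : ∀ u v → adj u v ≡ adj v u
    adj-irrefl : ∀ v → adj v v ≡ false

Subset : ℕ → Set
Subset n = Vector Bool n

allSubsets : (n : ℕ) → List (Subset n)
allSubsets zero = (λ ()) ∷ []
allSubsets (suc n) =
  map (λ S → λ { fz → false ; (fs i) → S i }) (allSubsets n) ++
  map (λ S → λ { fz → true  ; (fs i) → S i }) (allSubsets n)

allF : ∀ {n} → (Fin n → Bool) → Bool
allF {zero} p = true
allF {suc n} p = p fz ∧ allF (λ i → p (fs i))

anyF : ∀ {n} → (Fin n → Bool) → Bool
anyF p = not (allF (λ i → not (p i)))

card : ∀ {n} → Subset n → ℕ
card {zero} S = 0
card {suc n} S = (if S fz then 1 else 0) Data.Nat.+ card (λ i → S (fs i))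

_⊆ᵇ_ : ∀ {n} → Subset n → Subset n → Bool
S ⊆ᵇ T = allF (λ v → not (S v) ∨ T v)

isClique : ∀ {n} → Graph n → Subset n → Bool
isClique G S = allF (λ u → allF (λ v →
  not (S u ∧ S v) ∨ ⌊ u ≟F v ⌋ ∨ Graph.adj G u v))

-- copies of K_k in G whose vertex set lies inside T
-- (T = all vertices: copies of K_k in G; T = N(i): copies in G[N(i)])
cliquesIn : ∀ {n} → Graph n → ℕ → Subset n → List (Subset n)
cliquesIn {n} G k T =
  filter (λ S → (card S ≟ℕ k) Relation.Nullary.Decidable.×-dec
                 (Relation.Nullary.Decidable.T? (isClique G S ∧ (S ⊆ᵇ T))))
         (allSubsets n)

nbhd : ∀ {n} → Graph n → Fin n → Subset n
nbhd G i = Graph.adj G i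

fullSet : ∀ {n} → Subset n
fullSet _ = true

maxL : List ℕ → ℕ
maxL = foldr Data.Nat._⊔_ 0

cliqueNum : ∀ {n} → Graph n → Fin n → ℕ
cliqueNum {n} G v =
  maxL (map card (filter (λ S → Relation.Nullary.Decidable.T? (isClique G S ∧ S v))
                         (allSubsets n)))

module _ {c ℓ₁ ℓ₂} (F : OrderedField c ℓ₁ ℓ₂) where
  open OrderedField F

  coeff : ℕ → ℕ → Carrier
  coeff cv t = fromℕ (cv C t) * (fromℕ (cv ^ t)) ⁻¹

  InSimplex : ∀ {n} → Vector Carrier n → Set (ℓ₁ ⊔ ℓ₂)
  InSimplex x = (∀ v → 0# ≤ x v) Data.Product.× (sumF x ≈ 1#)

  Φ : ∀ {n} → Graph n → ℕ → Vector Carrier n → Carrier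
  Φ G t x = sumF (λ v → x v * coeff (cliqueNum G v) t)
            - sumL (map (λ S → prodSub S x) (cliquesIn G t fullSet))

  δ : ∀ {n} → Graph n → ℕ → Fin n → Fin n → Vector Carrier n → Carrier
  δ G t i j x =
    (coeff (cliqueNum G i) t - coeff (cliqueNum G j) t)
    - ( sumL (map (λ S → prodSub S x) (cliquesIn G (t Data.Nat.∸ 1) (nbhd G i)))
      - sumL (map (λ S → prodSub S x) (cliquesIn G (t Data.Nat.∸ 1) (nbhd G j))))

{-# OPTIONS --safe #-}
module Submission where

-- Φ(G,·) is affine in each coordinate.  A copy of K_t through i, with i removed, is a copy of
-- K_{t-1} inside N(i), so adding s to x_i changes Φ by s·(c_i − K_i), where K_i sums the
-- products over the copies of K_{t-1} in N(i).  When i and j are non-adjacent, no copy in N(j)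
-- contains i, so moving mass s from x_j to x_i changes Φ by exactly s·δ_ij(x).  Both transfers
-- s = x_j and s = −x_i stay in the simplex, so minimality gives x_j·δ_ij ≥ 0 ≥ x_i·δ_ij, and
-- δ_ij = 0 because x_i and x_j are positive.

open import Defs
open import Level using (Level)
open import Algebra.Bundles using (CommutativeRing)
open import Data.Bool using (Bool; true; false; T; not; _∧_; _∨_; if_then_else_)
open import Data.Bool.Properties using (T-∧; T-not-≡)
open import Data.Empty using (⊥-elim)
open import Data.Fin using (Fin) renaming (zero to fz; suc to fs; _≟_ to _≟F_)
import Data.Fin.Properties as Fin
open import Data.List using ([]; _∷_; _++_; map; filter)
open import Data.List.Properties using (map-∘)
open import Data.Nat as ℕ using (ℕ; zero; suc; _≡ᵇ_; _∸_) renaming (_≟_ to _≟ℕ_)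
open import Data.Nat.Properties using (≡ᵇ⇒≡; ≡⇒≡ᵇ; +-suc; suc-injective)
open import Data.Product using (_×_; _,_; proj₁; proj₂)
open import Data.Sum using (inj₁; inj₂)
open import Data.Unit using (tt)
open import Data.Vec.Functional as Vector using (Vector; updateAt)
open import Data.Vec.Functional.Properties using (updateAt-updates; updateAt-minimal)
open import Function.Base using (_∘_)
open import Function.Bundles using (_⇔_; mk⇔; Equivalence)
open import Relation.Binary using (IsTotalOrder; _Preserves_⟶_)
open import Relation.Binary.PropositionalEquality using (_≡_; _≢_; _≗_; refl; sym; trans; cong; cong₂; subst)
open import Relation.Nullary using (¬_; Dec; yes; no; does)
open import Relation.Nullary.Decidable using (⌊_⌋; _×-dec_; T?)
open import Relation.Unary using (Pred; Decidable)

open Equivalence using (to; from)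

private variable
  n k : ℕ

T-ext : ∀ {a b} → (T a → T b) → (T b → T a) → a ≡ b
T-ext {false} {false} _ _ = refl
T-ext {false} {true}  _ g = ⊥-elim (g tt)
T-ext {true}  {false} f _ = ⊥-elim (f tt)
T-ext {true}  {true}  _ _ = refl

T-allF : ∀ {p : Fin n → Bool} → T (allF p) ⇔ (∀ v → T (p v))
T-allF {zero}  = mk⇔ (λ _ ()) _
T-allF {suc n} {p} = mk⇔
  (λ h → let hz , hs = to T-∧ h in λ { fz → hz ; (fs v) → to T-allF hs v })
  (λ h → from T-∧ (h fz , from T-allF (λ v → h (fs v))))

allF-cong : ∀ {p q : Fin n → Bool} → p ≗ q → allF p ≡ allF q
allF-cong {zero}  e = refl
allF-cong {suc n} e = cong₂ _∧_ (e fz) (allF-cong (λ v → e (fs v)))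

_⊆_ : Subset n → Subset n → Set
S ⊆ U = ∀ v → T (S v) → T (U v)

IsClique : Graph n → Subset n → Set
IsClique G S = ∀ u v → T (S u) → T (S v) → u ≢ v → T (Graph.adj G u v)

T-⊆ᵇ : ∀ {S U : Subset n} → T (S ⊆ᵇ U) ⇔ S ⊆ U
T-⊆ᵇ {S = S} {U} = mk⇔
  (λ h v → entry (S v) (U v) (to T-allF h v))
  (λ h → from T-allF (λ v → entry⁻¹ (S v) (U v) (h v)))
  where
  entry : ∀ a b → T (not a ∨ b) → T a → T b
  entry true b h _ = h
  entry⁻¹ : ∀ a b → (T a → T b) → T (not a ∨ b)
  entry⁻¹ false b h = tt
  entry⁻¹ true  b h = h tt

T-isClique : ∀ {G : Graph n} {S} → T (isClique G S) ⇔ IsClique G S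
T-isClique {G = G} {S} = mk⇔
  (λ h u v → entry (S u) (S v) (u ≟F v) (adj u v) (to T-allF (to T-allF h u) v))
  (λ h → from T-allF (λ u → from T-allF (λ v → entry⁻¹ (S u) (S v) (u ≟F v) (adj u v) (h u v))))
  where
  open Graph G
  entry : ∀ {P : Set} a b (d : Dec P) c → T (not (a ∧ b) ∨ ⌊ d ⌋ ∨ c) → T a → T b → ¬ P → T c
  entry true true (yes p) c _ _ _ ¬p = ⊥-elim (¬p p)
  entry true true (no _)  c h _ _ _  = h
  entry⁻¹ : ∀ {P : Set} a b (d : Dec P) c → (T a → T b → ¬ P → T c) →
            T (not (a ∧ b) ∨ ⌊ d ⌋ ∨ c)
  entry⁻¹ false b     d       c h = tt
  entry⁻¹ true  false d       c h = tt
  entry⁻¹ true  true  (yes p) c h = tt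
  entry⁻¹ true  true  (no ¬p) c h = h tt tt ¬p

isCliqueIn : Graph n → ℕ → Subset n → Subset n → Bool
isCliqueIn G k U S = does ((card S ≟ℕ k) ×-dec T? (isClique G S ∧ (S ⊆ᵇ U)))

T-isCliqueIn : ∀ (G : Graph n) k U S → T (isCliqueIn G k U S) ⇔ (card S ≡ k × IsClique G S × S ⊆ U)
T-isCliqueIn G k U S = mk⇔
  (λ h → let c , r = to T-∧ h ; cl , sub = to T-∧ r in
     ≡ᵇ⇒≡ (card S) k c , to (T-isClique {G = G}) cl , to (T-⊆ᵇ {S = S} {U}) sub)
  (λ (c , cl , sub) →
     from T-∧ (≡⇒≡ᵇ (card S) k c ,
               from T-∧ (from (T-isClique {G = G}) cl , from (T-⊆ᵇ {S = S} {U}) sub)))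

card-cong : ∀ {S S′ : Subset n} → S ≗ S′ → card S ≡ card S′
card-cong {zero}  e = refl
card-cong {suc n} e = cong₂ (λ b m → (if b then 1 else 0) ℕ.+ m) (e fz) (card-cong (λ v → e (fs v)))

isCliqueIn-cong : ∀ {G : Graph n} {U S S′} → S ≗ S′ → isCliqueIn G k U S ≡ isCliqueIn G k U S′
isCliqueIn-cong {k = k} {G = G} {U} e =
  cong₂ (λ m b → (m ≡ᵇ k) ∧ b) (card-cong e)
    (cong₂ _∧_
      (allF-cong (λ u → allF-cong (λ v →
        cong₂ (λ a b → not (a ∧ b) ∨ ⌊ u ≟F v ⌋ ∨ Graph.adj G u v) (e u) (e v))))
      (allF-cong (λ v → cong (λ a → not a ∨ U v) (e v))))

toggle : Fin n → Subset n → Subset n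
toggle i S = updateAt S i not

toggle-self : (i : Fin n) (S : Subset n) → toggle i S i ≡ not (S i)
toggle-self i S = updateAt-updates i S

toggle-other : ∀ {i v : Fin n} (S : Subset n) → v ≢ i → toggle i S v ≡ S v
toggle-other {i = i} {v} S = updateAt-minimal v i S

∈-toggle⁺ : ∀ {i v : Fin n} (S : Subset n) → v ≢ i → T (S v) → T (toggle i S v)
∈-toggle⁺ S v≢i = subst T (sym (toggle-other S v≢i))

∈-toggle⁻ : ∀ {v : Fin n} i (S : Subset n) → T (S i) → T (toggle i S v) → v ≢ i × T (S v)
∈-toggle⁻ {v = v} i S si h with v ≟F i
... | yes refl = ⊥-elim (subst T (to T-not-≡ (subst T (toggle-self i S) h)) si)
... | no v≢i = v≢i , subst T (toggle-other S v≢i) h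

card-toggle : ∀ (i : Fin n) (S : Subset n) → T (S i) → card S ≡ suc (card (toggle i S))
card-toggle fz S si = step (S fz) si
  where
  step : ∀ b → T b → (if b then 1 else 0) ℕ.+ card (λ v → S (fs v))
                   ≡ suc ((if not b then 1 else 0) ℕ.+ card (λ v → S (fs v)))
  step true _ = refl
card-toggle (fs i) S si =
  trans (cong ((if S fz then 1 else 0) ℕ.+_) (card-toggle i (λ v → S (fs v)) si)) (+-suc _ _)

toggle-cong : ∀ (i : Fin n) {S S′ : Subset n} → S ≗ S′ → toggle i S ≗ toggle i S′
toggle-cong i {S} {S′} e v with v ≟F i
... | yes refl = trans (toggle-self i S) (trans (cong not (e i)) (sym (toggle-self i S′)))
... | no v≢i = trans (toggle-other S v≢i) (trans (e v) (sym (toggle-other S′ v≢i)))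

module _ (G : Graph n) where
  open Graph G

  toggle-⊆-nbhd⇒∈ : ∀ i S → toggle i S ⊆ nbhd G i → T (S i)
  toggle-⊆-nbhd⇒∈ i S sub with S i in eq
  ... | true = tt
  ... | false = ⊥-elim (subst T (adj-irrefl i) (sub i (subst T (sym (trans (toggle-self i S) (cong not eq))) tt)))

  clique-grow : ∀ i S → IsClique G (toggle i S) → toggle i S ⊆ nbhd G i → IsClique G S
  clique-grow i S cl sub u v su sv u≢v with u ≟F i | v ≟F i
  ... | yes refl | yes refl = ⊥-elim (u≢v refl)
  ... | yes refl | no v≢i = sub v (∈-toggle⁺ S v≢i sv)
  ... | no u≢i | yes refl = subst T (adj-sym i u) (sub u (∈-toggle⁺ S u≢i su))
  ... | no u≢i | no v≢i = cl u v (∈-toggle⁺ S u≢i su) (∈-toggle⁺ S v≢i sv) u≢v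

  clique-shrink : ∀ i S → IsClique G S → T (S i) → IsClique G (toggle i S) × toggle i S ⊆ nbhd G i
  clique-shrink i S cl si =
    (λ u v tu tv → cl u v (proj₂ (∈-toggle⁻ i S si tu)) (proj₂ (∈-toggle⁻ i S si tv))) ,
    (λ v tv → let v≢i , sv = ∈-toggle⁻ i S si tv in cl i v si sv (λ i≡v → v≢i (sym i≡v)))

  isCliqueIn-toggle : ∀ k i S →
    isCliqueIn G k (nbhd G i) (toggle i S) ≡ isCliqueIn G (suc k) fullSet S ∧ S i
  isCliqueIn-toggle k i S = T-ext grow shrink
    where
    grow : T (isCliqueIn G k (nbhd G i) (toggle i S)) → T (isCliqueIn G (suc k) fullSet S ∧ S i)
    grow h =
      let c , cl , sub = to (T-isCliqueIn G k (nbhd G i) (toggle i S)) h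
          si = toggle-⊆-nbhd⇒∈ i S sub
      in from T-∧ ( from (T-isCliqueIn G (suc k) fullSet S)
                      (trans (card-toggle i S si) (cong suc c) , clique-grow i S cl sub , λ _ _ → tt)
                  , si)
    shrink : T (isCliqueIn G (suc k) fullSet S ∧ S i) → T (isCliqueIn G k (nbhd G i) (toggle i S))
    shrink h =
      let h₁ , si = to T-∧ h
          c , cl , _ = to (T-isCliqueIn G (suc k) fullSet S) h₁
          cl′ , sub = clique-shrink i S cl si
      in from (T-isCliqueIn G k (nbhd G i) (toggle i S))
              (suc-injective (trans (sym (card-toggle i S si)) c) , cl′ , sub)

module Properties {c ℓ₁ ℓ₂} (F : OrderedField c ℓ₁ ℓ₂) where
  open OrderedField F
  open IsTotalOrder isTotalOrder using (total; antisym; ≲-respˡ-≈; ≲-respʳ-≈)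
    renaming (reflexive to ≤-reflexive; trans to ≤-trans)

  private
    commutativeRing : CommutativeRing c ℓ₁
    commutativeRing = record { isCommutativeRing = isCommutativeRing }

  open CommutativeRing commutativeRing
    using (setoid; +-cong; +-congˡ; +-congʳ; *-cong; *-congˡ; *-congʳ; -‿cong; +-assoc; +-comm
          ; +-identityˡ; +-identityʳ; *-identityˡ; *-assoc; zeroʳ; distribˡ; distribʳ
          ; *-comm; -‿inverseˡ; -‿inverseʳ; ring; +-commutativeSemigroup; *-commutativeSemigroup)
    renaming (refl to ≈-refl; sym to ≈-sym; trans to ≈-trans; reflexive to ≈-reflexive)
  open import Algebra.Properties.Ring ring
    using (-‿+-comm; -‿involutive; -‿distribˡ-*; -‿distribʳ-*; x[y-z]≈xy-xz; xyx⁻¹≈y)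
  open import Algebra.Properties.CommutativeSemigroup +-commutativeSemigroup
    using (interchange; xy∙z≈xz∙y)
  open import Algebra.Properties.CommutativeSemigroup *-commutativeSemigroup
    using () renaming (x∙yz≈y∙xz to x*yz≈y*xz)
  open import Relation.Binary.Reasoning.Setoid setoid

  [x+y]-[z+w]≈[x-z]+[y-w] : ∀ x y z w → (x + y) - (z + w) ≈ (x - z) + (y - w)
  [x+y]-[z+w]≈[x-z]+[y-w] x y z w =
    ≈-trans (+-congˡ (≈-sym (-‿+-comm z w))) (interchange x y (- z) (- w))

  [x-y]-[z-w]≈[x-z]-[y-w] : ∀ x y z w → (x - y) - (z - w) ≈ (x - z) - (y - w)
  [x-y]-[z-w]≈[x-z]-[y-w] x y z w = begin
    (x - y) - (z - w)          ≈⟨ [x+y]-[z+w]≈[x-z]+[y-w] x (- y) z (- w) ⟩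
    (x - z) + (- y - - w)      ≈⟨ +-congˡ (-‿+-comm y (- w)) ⟩
    (x - z) - (y - w)          ∎

  x+y-y≈x : ∀ x y → (x + y) - y ≈ x
  x+y-y≈x x y = ≈-trans (+-assoc x y (- y)) (≈-trans (+-congˡ (-‿inverseʳ y)) (+-identityʳ x))

  x≤x+d⇒0≤d : ∀ {x d} → x ≤ x + d → 0# ≤ d
  x≤x+d⇒0≤d {x} {d} h =
    ≲-respʳ-≈ (xyx⁻¹≈y x d) (≲-respˡ-≈ (-‿inverseʳ x) (+-monoˡ-≤ (- x) h))

  0≤x⇒0≤y⇒0≤x+y : ∀ {x y} → 0# ≤ x → 0# ≤ y → 0# ≤ x + y
  0≤x⇒0≤y⇒0≤x+y {x} {y} 0≤x 0≤y =
    ≤-trans (≲-respʳ-≈ (≈-sym (+-identityˡ y)) 0≤y) (+-monoˡ-≤ y 0≤x)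

  0≤-x⇒x≤0 : ∀ {x} → 0# ≤ - x → x ≤ 0#
  0≤-x⇒x≤0 {x} h = ≲-respʳ-≈ (-‿inverseˡ x) (≲-respˡ-≈ (+-identityˡ x) (+-monoˡ-≤ x h))

  x≤0⇒0≤-x : ∀ {x} → x ≤ 0# → 0# ≤ - x
  x≤0⇒0≤-x {x} h = ≲-respʳ-≈ (+-identityˡ (- x)) (≲-respˡ-≈ (-‿inverseʳ x) (+-monoˡ-≤ (- x) h))

  x*y≈0⇒y≈0 : ∀ {x y} → ¬ (x ≈ 0#) → x * y ≈ 0# → y ≈ 0#
  x*y≈0⇒y≈0 {x} {y} x≉0 xy≈0 = begin
    y                ≈⟨ ≈-sym (*-identityˡ y) ⟩
    1# * y           ≈⟨ *-congʳ (≈-sym (⁻¹-inverse x≉0)) ⟩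
    (x * x ⁻¹) * y   ≈⟨ *-congʳ (*-comm x (x ⁻¹)) ⟩
    (x ⁻¹ * x) * y   ≈⟨ *-assoc (x ⁻¹) x y ⟩
    x ⁻¹ * (x * y)   ≈⟨ *-congˡ xy≈0 ⟩
    x ⁻¹ * 0#        ≈⟨ zeroʳ (x ⁻¹) ⟩
    0#               ∎

  slope≈0 : ∀ {a b d} → 0# ≤ a → 0# ≤ b → ¬ (a ≈ 0#) → ¬ (b ≈ 0#) →
            0# ≤ b * d → 0# ≤ (- a) * d → d ≈ 0#
  slope≈0 {a} {b} {d} 0≤a 0≤b a≉0 b≉0 0≤bd 0≤-ad with total d 0#
  ... | inj₁ d≤0 = x*y≈0⇒y≈0 b≉0 (antisym bd≤0 0≤bd)
    where
    bd≤0 : b * d ≤ 0#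
    bd≤0 = 0≤-x⇒x≤0 (≲-respʳ-≈ (≈-sym (-‿distribʳ-* b d)) (*-nonneg 0≤b (x≤0⇒0≤-x d≤0)))
  ... | inj₂ 0≤d = x*y≈0⇒y≈0 a≉0 (antisym ad≤0 (*-nonneg 0≤a 0≤d))
    where
    ad≤0 : a * d ≤ 0#
    ad≤0 = 0≤-x⇒x≤0 (≲-respʳ-≈ (≈-sym (-‿distribˡ-* a d)) 0≤-ad)

  when : Bool → Carrier → Carrier
  when b x = if b then x else 0#

  when-cong : ∀ b {x y} → (T b → x ≈ y) → when b x ≈ when b y
  when-cong false _ = ≈-refl
  when-cong true  h = h tt

  when-+ : ∀ b x y → when b (x + y) ≈ when b x + when b y
  when-+ false _ _ = ≈-sym (+-identityʳ 0#)
  when-+ true  _ _ = ≈-refl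

  when-* : ∀ b x y → when b (x * y) ≈ x * when b y
  when-* false x _ = ≈-sym (zeroʳ x)
  when-* true  _ _ = ≈-refl

  when-∧ : ∀ a b x → when a (when b x) ≡ when (a ∧ b) x
  when-∧ false _ _ = refl
  when-∧ true  _ _ = refl

  module _ {a} {A : Set a} where

    sumL-cong : ∀ {f g : A → Carrier} xs → (∀ x → f x ≈ g x) → sumL (map f xs) ≈ sumL (map g xs)
    sumL-cong []       _ = ≈-refl
    sumL-cong (x ∷ xs) e = +-cong (e x) (sumL-cong xs e)

    sumL-+ : ∀ (f g : A → Carrier) xs → sumL (map (λ x → f x + g x) xs) ≈ sumL (map f xs) + sumL (map g xs)
    sumL-+ f g []       = ≈-sym (+-identityʳ 0#)
    sumL-+ f g (x ∷ xs) = ≈-trans (+-congˡ (sumL-+ f g xs)) (interchange (f x) (g x) _ _)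

    sumL-* : ∀ y (f : A → Carrier) xs → sumL (map (λ x → y * f x) xs) ≈ y * sumL (map f xs)
    sumL-* y f []       = ≈-sym (zeroʳ y)
    sumL-* y f (x ∷ xs) = ≈-trans (+-congˡ (sumL-* y f xs)) (≈-sym (distribˡ y _ _))

    sumL-++ : ∀ (f : A → Carrier) xs ys → sumL (map f (xs ++ ys)) ≈ sumL (map f xs) + sumL (map f ys)
    sumL-++ f []       ys = ≈-sym (+-identityˡ _)
    sumL-++ f (x ∷ xs) ys = ≈-trans (+-congˡ (sumL-++ f xs ys)) (≈-sym (+-assoc _ _ _))

    sumL-filter : ∀ {p} {P : Pred A p} (P? : Decidable P) (f : A → Carrier) xs →
                  sumL (map f (filter P? xs)) ≈ sumL (map (λ x → when (does (P? x)) (f x)) xs)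
    sumL-filter P? f [] = ≈-refl
    sumL-filter P? f (x ∷ xs) with does (P? x)
    ... | true  = +-congˡ (sumL-filter P? f xs)
    ... | false = ≈-trans (sumL-filter P? f xs) (≈-sym (+-identityˡ _))

  sumSubsets : (Subset n → Carrier) → Carrier
  sumSubsets {n} g = sumL (map g (allSubsets n))

  sumSubsets-cong : ∀ {g h : Subset n → Carrier} → (∀ S → g S ≈ h S) → sumSubsets g ≈ sumSubsets h
  sumSubsets-cong {n} = sumL-cong (allSubsets n)

  sumSubsets-suc : ∀ (g : Subset (suc n) → Carrier) → g Preserves _≗_ ⟶ _≈_ →
                   sumSubsets g ≈ sumSubsets (λ S → g (false Vector.∷ S))
                                  + sumSubsets (λ S → g (true Vector.∷ S))
  sumSubsets-suc {n} g g-cong = ≈-trans (sumL-++ g (map _ (allSubsets n)) (map _ (allSubsets n)))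
    (+-cong (prefixed false _ (λ S → λ { fz → refl ; (fs _) → refl }))
            (prefixed true  _ (λ S → λ { fz → refl ; (fs _) → refl })))
    where
    prefixed : ∀ b (e : Subset n → Subset (suc n)) → (∀ S → e S ≗ (b Vector.∷ S)) →
               sumL (map g (map e (allSubsets n))) ≈ sumSubsets (λ S → g (b Vector.∷ S))
    prefixed b e e≗ = ≈-trans (≈-reflexive (cong sumL (sym (map-∘ (allSubsets n)))))
                              (sumL-cong (allSubsets n) (λ S → g-cong (e≗ S)))

  -- Subsets are functions, so toggling twice returns S only up to _≗_; hence the hypothesis on g.
  sumSubsets-toggle : ∀ (i : Fin n) (g : Subset n → Carrier) → g Preserves _≗_ ⟶ _≈_ →
                      sumSubsets (λ S → g (toggle i S)) ≈ sumSubsets g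
  sumSubsets-toggle {suc n} fz g g-cong = begin
    sumSubsets (λ S → g (toggle fz S))
      ≈⟨ sumSubsets-suc _ (λ e → g-cong (toggle-cong fz e)) ⟩
    sumSubsets (λ S → g (toggle fz (false Vector.∷ S))) + sumSubsets (λ S → g (toggle fz (true Vector.∷ S)))
      ≈⟨ +-cong (sumSubsets-cong {n} (λ S → g-cong λ { fz → refl ; (fs _) → refl }))
                (sumSubsets-cong {n} (λ S → g-cong λ { fz → refl ; (fs _) → refl })) ⟩
    sumSubsets (λ S → g (true Vector.∷ S)) + sumSubsets (λ S → g (false Vector.∷ S))
      ≈⟨ +-comm _ _ ⟩
    sumSubsets (λ S → g (false Vector.∷ S)) + sumSubsets (λ S → g (true Vector.∷ S))
      ≈⟨ sumSubsets-suc g g-cong ⟨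
    sumSubsets g ∎
  sumSubsets-toggle {suc n} (fs i) g g-cong = begin
    sumSubsets (λ S → g (toggle (fs i) S))
      ≈⟨ sumSubsets-suc _ (λ e → g-cong (toggle-cong (fs i) e)) ⟩
    sumSubsets (λ S → g (toggle (fs i) (false Vector.∷ S)))
      + sumSubsets (λ S → g (toggle (fs i) (true Vector.∷ S)))
      ≈⟨ +-cong (sumSubsets-cong {n} (λ S → g-cong λ { fz → refl ; (fs _) → refl }))
                (sumSubsets-cong {n} (λ S → g-cong λ { fz → refl ; (fs _) → refl })) ⟩
    sumSubsets (λ S → g (false Vector.∷ toggle i S)) + sumSubsets (λ S → g (true Vector.∷ toggle i S))
      ≈⟨ +-cong (sumSubsets-toggle i (λ S → g (false Vector.∷ S)) (λ e → g-cong (∷-cong false e)))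
                (sumSubsets-toggle i (λ S → g (true Vector.∷ S)) (λ e → g-cong (∷-cong true e))) ⟩
    sumSubsets (λ S → g (false Vector.∷ S)) + sumSubsets (λ S → g (true Vector.∷ S))
      ≈⟨ sumSubsets-suc g g-cong ⟨
    sumSubsets g ∎
    where
    ∷-cong : ∀ b {S S′ : Subset n} → S ≗ S′ → (b Vector.∷ S) ≗ (b Vector.∷ S′)
    ∷-cong b e fz     = refl
    ∷-cong b e (fs v) = e v

  prodSub-cong : ∀ {S S′ : Subset n} (z : Vector Carrier n) → S ≗ S′ → prodSub S z ≈ prodSub S′ z
  prodSub-cong {zero}  z e = ≈-refl
  prodSub-cong {suc n} z e =
    *-cong (≈-reflexive (cong (λ b → if b then z fz else 1#) (e fz)))
           (prodSub-cong (λ v → z (fs v)) (λ v → e (fs v)))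

  prodSub-congʳ : ∀ (S : Subset n) {y z : Vector Carrier n} → (∀ v → T (S v) → y v ≈ z v) →
                  prodSub S y ≈ prodSub S z
  prodSub-congʳ {zero}  S e = ≈-refl
  prodSub-congʳ {suc n} S e = *-cong (factor (S fz) (e fz)) (prodSub-congʳ (λ v → S (fs v)) (λ v → e (fs v)))
    where
    factor : ∀ b {p q} → (T b → p ≈ q) → (if b then p else 1#) ≈ (if b then q else 1#)
    factor false _ = ≈-refl
    factor true  h = h tt

  prodSub-toggle : ∀ (i : Fin n) (S : Subset n) (z : Vector Carrier n) → T (S i) →
                   prodSub S z ≈ z i * prodSub (toggle i S) z
  prodSub-toggle fz S z si = step (S fz) si
    where
    step : ∀ b → T b → (if b then z fz else 1#) * prodSub (λ v → S (fs v)) (λ v → z (fs v))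
                     ≈ z fz * ((if not b then z fz else 1#) * prodSub (λ v → S (fs v)) (λ v → z (fs v)))
    step true _ = *-congˡ (≈-sym (*-identityˡ _))
  prodSub-toggle (fs i) S z si =
    ≈-trans (*-congˡ (prodSub-toggle i (λ v → S (fs v)) (λ v → z (fs v)) si)) (x*yz≈y*xz _ _ _)

  prodSub-updateAt-+ : ∀ (i : Fin n) (S : Subset n) (x : Vector Carrier n) s →
    prodSub S (updateAt x i (_+ s)) ≈ prodSub S x + when (S i) (s * prodSub (toggle i S) x)
  prodSub-updateAt-+ i S x s with S i in eq
  ... | true = begin
    prodSub S (updateAt x i (_+ s))
      ≈⟨ prodSub-toggle i S _ si ⟩
    updateAt x i (_+ s) i * prodSub (toggle i S) (updateAt x i (_+ s))
      ≈⟨ *-cong (≈-reflexive (updateAt-updates i x)) (prodSub-congʳ (toggle i S) off) ⟩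
    (x i + s) * prodSub (toggle i S) x
      ≈⟨ distribʳ _ _ _ ⟩
    x i * prodSub (toggle i S) x + s * prodSub (toggle i S) x
      ≈⟨ +-congʳ (prodSub-toggle i S x si) ⟨
    prodSub S x + s * prodSub (toggle i S) x ∎
    where
    si : T (S i)
    si = subst T (sym eq) tt
    off : ∀ v → T (toggle i S v) → updateAt x i (_+ s) v ≈ x v
    off v tv = ≈-reflexive (updateAt-minimal v i x (proj₁ (∈-toggle⁻ i S si tv)))
  ... | false = ≈-trans (prodSub-congʳ S off) (≈-sym (+-identityʳ _))
    where
    off : ∀ v → T (S v) → updateAt x i (_+ s) v ≈ x v
    off v sv = ≈-reflexive (updateAt-minimal v i x (λ { refl → subst T eq sv }))

  sumF-cong : ∀ {y z : Vector Carrier n} → (∀ v → y v ≈ z v) → sumF y ≈ sumF z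
  sumF-cong {zero}  e = ≈-refl
  sumF-cong {suc n} e = +-cong (e fz) (sumF-cong (λ v → e (fs v)))

  sumF-update : ∀ (i : Fin n) {y x : Vector Carrier n} {d} →
                (∀ v → v ≢ i → y v ≈ x v) → y i ≈ x i + d → sumF y ≈ sumF x + d
  sumF-update fz     off at = ≈-trans (+-cong at (sumF-cong (λ v → off (fs v) (λ ())))) (xy∙z≈xz∙y _ _ _)
  sumF-update (fs i) off at =
    ≈-trans (+-cong (off fz (λ ())) (sumF-update i (λ v v≢i → off (fs v) (v≢i ∘ Fin.suc-injective)) at))
            (≈-sym (+-assoc _ _ _))

  sumF-updateAt-+ : ∀ (i : Fin n) x s → sumF (updateAt x i (_+ s)) ≈ sumF x + s
  sumF-updateAt-+ i x s =
    sumF-update i (λ v v≢i → ≈-reflexive (updateAt-minimal v i x v≢i)) (≈-reflexive (updateAt-updates i x))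

  cliqueSum : Graph n → ℕ → Subset n → Vector Carrier n → Carrier
  cliqueSum G k U z = sumL (map (λ S → prodSub S z) (cliquesIn G k U))

  cliqueSum-sumSubsets : ∀ (G : Graph n) k U z →
    cliqueSum G k U z ≈ sumSubsets (λ S → when (isCliqueIn G k U S) (prodSub S z))
  cliqueSum-sumSubsets {n} G k U z = sumL-filter _ (λ S → prodSub S z) (allSubsets n)

  module _ (G : Graph n) where

    cliqueSum-nbhd : ∀ k i z → cliqueSum G k (nbhd G i) z ≈
      sumSubsets (λ S → when (isCliqueIn G (suc k) fullSet S ∧ S i) (prodSub (toggle i S) z))
    cliqueSum-nbhd k i z = begin
      cliqueSum G k (nbhd G i) z
        ≈⟨ cliqueSum-sumSubsets G k (nbhd G i) z ⟩
      sumSubsets (λ S → when (isCliqueIn G k (nbhd G i) S) (prodSub S z))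
        ≈⟨ sumSubsets-toggle i _ summand-cong ⟨
      sumSubsets (λ S → when (isCliqueIn G k (nbhd G i) (toggle i S)) (prodSub (toggle i S) z))
        ≈⟨ sumSubsets-cong (λ S → ≈-reflexive (cong (λ b → when b _) (isCliqueIn-toggle G k i S))) ⟩
      sumSubsets (λ S → when (isCliqueIn G (suc k) fullSet S ∧ S i) (prodSub (toggle i S) z)) ∎
      where
      summand-cong : (λ S → when (isCliqueIn G k (nbhd G i) S) (prodSub S z)) Preserves _≗_ ⟶ _≈_
      summand-cong {S} e = ≈-trans (≈-reflexive (cong (λ b → when b (prodSub S z)) (isCliqueIn-cong {G = G} e)))
                                   (when-cong _ (λ _ → prodSub-cong z e))

    cliqueSum-updateAt-+ : ∀ k i x s → cliqueSum G (suc k) fullSet (updateAt x i (_+ s))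
                                       ≈ cliqueSum G (suc k) fullSet x + s * cliqueSum G k (nbhd G i) x
    cliqueSum-updateAt-+ k i x s = begin
      cliqueSum G (suc k) fullSet (updateAt x i (_+ s))
        ≈⟨ cliqueSum-sumSubsets G (suc k) fullSet _ ⟩
      sumSubsets (λ S → when (C S) (prodSub S (updateAt x i (_+ s))))
        ≈⟨ sumSubsets-cong (λ S →
             ≈-trans (when-cong (C S) (λ _ → prodSub-updateAt-+ i S x s)) (when-+ (C S) _ _)) ⟩
      sumSubsets (λ S → when (C S) (prodSub S x) + when (C S) (when (S i) (s * P S)))
        ≈⟨ sumL-+ _ _ (allSubsets n) ⟩
      sumSubsets (λ S → when (C S) (prodSub S x)) + sumSubsets (λ S → when (C S) (when (S i) (s * P S)))
        ≈⟨ +-congˡ (sumSubsets-cong (λ S →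
             ≈-trans (≈-reflexive (when-∧ (C S) (S i) _)) (when-* (C S ∧ S i) s _))) ⟩
      sumSubsets (λ S → when (C S) (prodSub S x)) + sumSubsets (λ S → s * when (C S ∧ S i) (P S))
        ≈⟨ +-cong (≈-sym (cliqueSum-sumSubsets G (suc k) fullSet x)) (sumL-* s _ (allSubsets n)) ⟩
      cliqueSum G (suc k) fullSet x + s * sumSubsets (λ S → when (C S ∧ S i) (P S))
        ≈⟨ +-congˡ (*-congˡ (cliqueSum-nbhd k i x)) ⟨
      cliqueSum G (suc k) fullSet x + s * cliqueSum G k (nbhd G i) x ∎
      where
      C : Subset n → Bool
      C = isCliqueIn G (suc k) fullSet
      P : Subset n → Carrier
      P S = prodSub (toggle i S) x

    cliqueSum-updateAt-outside : ∀ k U i f x → U i ≡ false →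
                                 cliqueSum G k U (updateAt x i f) ≈ cliqueSum G k U x
    cliqueSum-updateAt-outside k U i f x Ui≡false =
      ≈-trans (cliqueSum-sumSubsets G k U _)
        (≈-trans (sumSubsets-cong (λ S →
                    when-cong (isCliqueIn G k U S) (λ h → prodSub-congʳ S (unchanged S h))))
                 (≈-sym (cliqueSum-sumSubsets G k U x)))
      where
      unchanged : ∀ S → T (isCliqueIn G k U S) → ∀ v → T (S v) → updateAt x i f v ≈ x v
      unchanged S h v sv = ≈-reflexive (updateAt-minimal v i x λ { refl →
        subst T Ui≡false (proj₂ (proj₂ (to (T-isCliqueIn G k U S) h)) i sv) })

  linearPart : Graph n → ℕ → Vector Carrier n → Carrier
  linearPart G t x = sumF (λ v → x v * coeff F (cliqueNum G v) t)

  ∂Φ : Graph n → ℕ → Fin n → Vector Carrier n → Carrier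
  ∂Φ G t i x = coeff F (cliqueNum G i) t - cliqueSum G (t ∸ 1) (nbhd G i) x

  δ≈∂Φ-∂Φ : ∀ (G : Graph n) t i j x → δ F G t i j x ≈ ∂Φ G t i x - ∂Φ G t j x
  δ≈∂Φ-∂Φ G t i j x = [x-y]-[z-w]≈[x-z]-[y-w] _ _ _ _

  linearPart-updateAt-+ : ∀ (G : Graph n) t i x s →
    linearPart G t (updateAt x i (_+ s)) ≈ linearPart G t x + s * coeff F (cliqueNum G i) t
  linearPart-updateAt-+ G t i x s =
    sumF-update i (λ v v≢i → *-congʳ (≈-reflexive (updateAt-minimal v i x v≢i)))
                  (≈-trans (*-congʳ (≈-reflexive (updateAt-updates i x))) (distribʳ _ _ _))

  Φ-updateAt-+ : ∀ (G : Graph n) k i x s →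
    Φ F G (suc k) (updateAt x i (_+ s)) ≈ Φ F G (suc k) x + s * ∂Φ G (suc k) i x
  Φ-updateAt-+ G k i x s = begin
    linearPart G (suc k) (updateAt x i (_+ s)) - cliqueSum G (suc k) fullSet (updateAt x i (_+ s))
      ≈⟨ +-cong (linearPart-updateAt-+ G (suc k) i x s) (-‿cong (cliqueSum-updateAt-+ G k i x s)) ⟩
    (linearPart G (suc k) x + s * cᵢ) - (cliqueSum G (suc k) fullSet x + s * Kᵢ)
      ≈⟨ [x+y]-[z+w]≈[x-z]+[y-w] _ _ _ _ ⟩
    Φ F G (suc k) x + (s * cᵢ - s * Kᵢ)
      ≈⟨ +-congˡ (x[y-z]≈xy-xz s cᵢ Kᵢ) ⟨
    Φ F G (suc k) x + s * (cᵢ - Kᵢ) ∎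
    where
    cᵢ Kᵢ : Carrier
    cᵢ = coeff F (cliqueNum G i) (suc k)
    Kᵢ = cliqueSum G k (nbhd G i) x

  ∂Φ-updateAt-nonadjacent : ∀ (G : Graph n) t {i j} f x → Graph.adj G j i ≡ false →
                            ∂Φ G t j (updateAt x i f) ≈ ∂Φ G t j x
  ∂Φ-updateAt-nonadjacent G t {i} {j} f x j≁i =
    +-congˡ (-‿cong (cliqueSum-updateAt-outside G (t ∸ 1) (nbhd G j) i f x j≁i))

  transfer : Fin n → Fin n → Carrier → Vector Carrier n → Vector Carrier n
  transfer i j s x = updateAt (updateAt x i (_+ s)) j (_- s)

  Φ-transfer : ∀ (G : Graph n) k {i j} x s → Graph.adj G j i ≡ false →
               Φ F G (suc k) (transfer i j s x) ≈ Φ F G (suc k) x + s * δ F G (suc k) i j x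
  Φ-transfer G k {i} {j} x s j≁i = begin
    Φ F G (suc k) (transfer i j s x)
      ≈⟨ Φ-updateAt-+ G k j (updateAt x i (_+ s)) (- s) ⟩
    Φ F G (suc k) (updateAt x i (_+ s)) + (- s) * ∂Φ G (suc k) j (updateAt x i (_+ s))
      ≈⟨ +-cong (Φ-updateAt-+ G k i x s) (*-congˡ (∂Φ-updateAt-nonadjacent G (suc k) (_+ s) x j≁i)) ⟩
    (Φ F G (suc k) x + s * ∂Φ G (suc k) i x) + (- s) * ∂Φ G (suc k) j x
      ≈⟨ +-assoc _ _ _ ⟩
    Φ F G (suc k) x + (s * ∂Φ G (suc k) i x + (- s) * ∂Φ G (suc k) j x)
      ≈⟨ +-congˡ (+-congˡ (-‿distribˡ-* s _)) ⟨
    Φ F G (suc k) x + (s * ∂Φ G (suc k) i x - s * ∂Φ G (suc k) j x)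
      ≈⟨ +-congˡ (x[y-z]≈xy-xz s _ _) ⟨
    Φ F G (suc k) x + s * (∂Φ G (suc k) i x - ∂Φ G (suc k) j x)
      ≈⟨ +-congˡ (*-congˡ (δ≈∂Φ-∂Φ G (suc k) i j x)) ⟨
    Φ F G (suc k) x + s * δ F G (suc k) i j x ∎

  module _ {i j : Fin n} {x : Vector Carrier n} {s : Carrier} where

    transfer-source : i ≢ j → transfer i j s x i ≡ x i + s
    transfer-source i≢j = trans (updateAt-minimal i j _ i≢j) (updateAt-updates i x)

    transfer-target : j ≢ i → transfer i j s x j ≡ x j - s
    transfer-target j≢i = trans (updateAt-updates j _) (cong (_- s) (updateAt-minimal j i x j≢i))

    transfer-other : ∀ {v} → v ≢ i → v ≢ j → transfer i j s x v ≡ x v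
    transfer-other v≢i v≢j = trans (updateAt-minimal _ j _ v≢j) (updateAt-minimal _ i x v≢i)

  transfer-InSimplex : ∀ {i j : Fin n} {x s} → InSimplex F x → i ≢ j →
                       0# ≤ x i + s → 0# ≤ x j - s → InSimplex F (transfer i j s x)
  transfer-InSimplex {i = i} {j} {x} {s} (x≥0 , Σx≈1) i≢j 0≤xi+s 0≤xj-s = nonneg , sum≈1
    where
    x′ : Vector Carrier _
    x′ = updateAt x i (_+ s)
    nonneg : ∀ v → 0# ≤ transfer i j s x v
    nonneg v with v ≟F i | v ≟F j
    ... | yes refl | _       = subst (0# ≤_) (sym (transfer-source i≢j)) 0≤xi+s
    ... | no v≢i  | yes refl = subst (0# ≤_) (sym (transfer-target v≢i)) 0≤xj-s
    ... | no v≢i  | no v≢j   = subst (0# ≤_) (sym (transfer-other v≢i v≢j)) (x≥0 v)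
    sum≈1 : sumF (transfer i j s x) ≈ 1#
    sum≈1 = begin
      sumF (transfer i j s x)
        ≈⟨ sumF-updateAt-+ j x′ (- s) ⟩
      sumF x′ - s
        ≈⟨ +-congʳ (sumF-updateAt-+ i x s) ⟩
      (sumF x + s) - s
        ≈⟨ x+y-y≈x (sumF x) s ⟩
      sumF x
        ≈⟨ Σx≈1 ⟩
      1# ∎

  minimiser⇒0≤slope : ∀ (G : Graph n) k {x} → InSimplex F x →
    (∀ y → InSimplex F y → Φ F G (suc k) x ≤ Φ F G (suc k) y) →
    ∀ {i j} s → i ≢ j → Graph.adj G i j ≡ false →
    0# ≤ x i + s → 0# ≤ x j - s → 0# ≤ s * δ F G (suc k) i j x
  minimiser⇒0≤slope G k {x} x∈Δ minimal {i} {j} s i≢j i≁j 0≤xi+s 0≤xj-s =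
    x≤x+d⇒0≤d (≲-respʳ-≈ (Φ-transfer G k x s (trans (Graph.adj-sym G j i) i≁j))
                         (minimal _ (transfer-InSimplex x∈Δ i≢j 0≤xi+s 0≤xj-s)))

  minimiser⇒δ≈0 : ∀ (G : Graph n) k {x} → InSimplex F x →
    (∀ y → InSimplex F y → Φ F G (suc k) x ≤ Φ F G (suc k) y) →
    ∀ {i j} → ¬ (x i ≈ 0#) → ¬ (x j ≈ 0#) → Graph.adj G i j ≡ false → δ F G (suc k) i j x ≈ 0#
  minimiser⇒δ≈0 G k {x} x∈Δ minimal {i} {j} xi≉0 xj≉0 i≁j with i ≟F j
  ... | yes refl = ≈-trans (δ≈∂Φ-∂Φ G (suc k) i i x) (-‿inverseʳ _)
  ... | no i≢j = slope≈0 (x≥0 i) (x≥0 j) xi≉0 xj≉0 move-xj-to-i move-xi-to-j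
    where
    x≥0 : ∀ v → 0# ≤ x v
    x≥0 = proj₁ x∈Δ
    move-xj-to-i : 0# ≤ x j * δ F G (suc k) i j x
    move-xj-to-i = minimiser⇒0≤slope G k x∈Δ minimal (x j) i≢j i≁j
      (0≤x⇒0≤y⇒0≤x+y (x≥0 i) (x≥0 j)) (≤-reflexive (≈-sym (-‿inverseʳ (x j))))
    move-xi-to-j : 0# ≤ (- x i) * δ F G (suc k) i j x
    move-xi-to-j = minimiser⇒0≤slope G k x∈Δ minimal (- x i) i≢j i≁j
      (≤-reflexive (≈-sym (-‿inverseʳ (x i))))
      (≲-respʳ-≈ (+-congˡ (≈-sym (-‿involutive (x i)))) (0≤x⇒0≤y⇒0≤x+y (x≥0 j) (x≥0 i)))

-- imported only here because inside Properties _≤_ denotes the order of F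
open import Data.Nat using (_≤_; s≤s)

lemma1 : ∀ {c ℓ₁ ℓ₂ : Level} (F : OrderedField c ℓ₁ ℓ₂) (n : ℕ) (G : Graph n) (t : ℕ)
             → 2 ≤ t
             → (x : Vector (OrderedField.Carrier F) n)
             → InSimplex F x
             → (∀ (y : Vector (OrderedField.Carrier F) n) → InSimplex F y
                  → OrderedField._≤_ F (Φ F G t x) (Φ F G t y))
             → (i j : Fin n)
             → ¬ (OrderedField._≈_ F (x i) (OrderedField.0# F))
             → ¬ (OrderedField._≈_ F (x j) (OrderedField.0# F))
             → Graph.adj G i j ≡ false
             → OrderedField._≈_ F (δ F G t i j x) (OrderedField.0# F)
-- only 1 ≤ t is used
lemma1 F n G (suc k) (s≤s _) x x∈Δ minimal i j = Properties.minimiser⇒δ≈0 F G k x∈Δ minimal
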